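{- Let $\mathtt{FitF}$ and $\mathtt{Sim}$ be run on the same request sequence $\sigma\in[n]^T$ with cache size $k$, from arbitrary initial cache configurations. Let $d_t=k-|C_t\cap\hat C_t|$ and let $e_t$, $\hat e_t$ denote the pages evicted at round $t$ by $\mathtt{FitF}$ and $\mathtt{Sim}$ respectively. Then for every round $t\in[T]$ with $d_{t+1}-d_t=1$, both $e_t$ and $\hat e_t$ exist, and $A_t(\hat e_t)<A_t(e_t)$ and $\hat p_t(e_t)\le\hat p_t(\hat e_t)$.
   Context: Paging with $n$ pages and cache of exactly $k<n$ pages; at round $t$, on a cache miss ($\sigma_t$ not in cache) the algorithm evicts one cached page and inserts $\sigma_t$, otherwise the cache is unchanged. $C_t$ and $\hat C_t$ are the cache configurations of $\mathtt{FitF}$ and $\mathtt{Sim}$ at round $t$ ($C_{t+1},\hat C_{t+1}$ after serving $\sigma_t$). With virtual requests $\sigma_{T+i}=i$, $A_t(i)=\min\{t'>t:\sigma_{t'}=i\}$. $\mathtt{FitF}$ evicts the cached page maximizing $A_t(i)$. $\mathtt{Sim}$, given NAT predictions $p_t\in(t,T+n]$, evicts the cached page maximizing the remedy prediction $\hat p_t(i)$ (ties arbitrary), where for an integer $Z>T+n$: $\hat p_1(i)=p_1$ if $i=\sigma_1$, else $Z+1$; for $t\ge2$, $\hat p_t(i)=p_t$ if $i=\sigma_t$; $\hat p_t(i)=Z$ if $\hat p_{t-1}(i)\le t$, $i\ne\sigma_t$ and $\hat p_{t-1}(i)\le\hat p_{t-1}(\sigma_t)<Z$; else $\hat p_t(i)=\hat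 p_{t-1}(i)$. -}

module Defs where

open import Data.Nat using (ℕ; zero; suc; _+_; _∸_; _≤_; _<_; _≤?_; _<?_)
open import Data.Fin using (Fin; toℕ; fromℕ<) renaming (_≟_ to _≟ᶠ_)
open import Data.Fin.Subset using (Subset; _∈_; _∉_; _∪_; _-_; ⁅_⁆; ∣_∣; _∩_)
open import Data.Maybe using (Maybe; just; nothing)
open import Data.Product using (_×_; ∃)
open import Data.Sum using (_⊎_)
open import Relation.Binary.PropositionalEquality using (_≡_)
open import Relation.Nullary using (yes; no)

-- Pages: the paper's page j ∈ [n] = {1..n} is represented by  i : Fin n  with
-- toℕ i = j - 1.  Rounds are natural numbers 1, 2, …; the real requests are
-- σ 1 … σ T (values of σ at other indices are irrelevant).

-- Extended request sequence: σ_t for 1 ≤ t ≤ T, and the virtual requests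
-- σ_{T+j} = j (Fin index j-1) for 1 ≤ j ≤ n; nothing otherwise.
ext : {n : ℕ} → (ℕ → Fin n) → ℕ → ℕ → Maybe (Fin n)
ext {n} σ T t with t ≤? T
... | yes _ = just (σ t)
... | no _ with t ∸ T ∸ 1 <? n
...   | yes p = just (fromℕ< p)
...   | no _  = nothing

searchNext : {n : ℕ} → (ℕ → Fin n) → ℕ → Fin n → ℕ → ℕ → ℕ
searchNext σ T i zero    t' = t'
searchNext σ T i (suc f) t' with ext σ T t'
... | nothing = searchNext σ T i f (suc t')
... | just j with j ≟ᶠ i
...   | yes _ = t'
...   | no _  = searchNext σ T i f (suc t')

-- A_t(i) = min { t' > t : σ_{t'} = i }  (over the extended sequence).
-- For 1 ≤ t ≤ T the search range (t, t+T+n] contains the virtual request of i,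
-- so the fuel bound is never hit.
A : {n : ℕ} → (ℕ → Fin n) → ℕ → ℕ → Fin n → ℕ
A {n} σ T t i = searchNext σ T i (T + n) (suc t)

phatStep : {n : ℕ} → (ℕ → Fin n) → (ℕ → ℕ) → ℕ → ℕ → (Fin n → ℕ) → Fin n → ℕ
phatStep σ p Z u prev i with i ≟ᶠ σ u
... | yes _ = p u
... | no _ with prev i ≤? u | prev i ≤? prev (σ u) | prev (σ u) <? Z
...   | yes _ | yes _ | yes _ = Z
...   | _     | _     | _     = prev i

-- Remedy predictions  p̂_t(i)  from the NAT predictions p (p t = p_t), with
-- the integer parameter Z.  (p̂_0 is never used.)
phat : {n : ℕ} → (ℕ → Fin n) → (ℕ → ℕ) → ℕ → ℕ → Fin n → ℕ
phat σ p Z zero i = suc Z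
phat σ p Z (suc zero) i with i ≟ᶠ σ 1
... | yes _ = p 1
... | no _  = suc Z
phat σ p Z (suc (suc t)) i = phatStep σ p Z (suc (suc t)) (phat σ p Z (suc t)) i

Step : {n : ℕ} → (Fin n → ℕ) → Fin n → Subset n → Subset n → Maybe (Fin n) → Set
Step score r C C' e =
    (r ∈ C × C' ≡ C × e ≡ nothing)
  ⊎ ∃ λ x → r ∉ C × x ∈ C × e ≡ just x × C' ≡ (C - x) ∪ ⁅ r ⁆
          × (∀ y → y ∈ C → score y ≤ score x)

-- A run over rounds 1..T: C t is the cache at round t (C (T+1) the final one),
-- E t the page evicted at round t.  score t is the eviction priority at round t.
Run : {n : ℕ} → (ℕ → Fin n → ℕ) → (ℕ → Fin n) → ℕ → (ℕ → Subset n) → (ℕ → Maybe (Fin n)) → Set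
Run score σ T C E = ∀ t → 1 ≤ t → t ≤ T → Step (score t) (σ t) (C t) (C (suc t)) (E t)

FitFRun : {n : ℕ} → (ℕ → Fin n) → ℕ → (ℕ → Subset n) → (ℕ → Maybe (Fin n)) → Set
FitFRun σ T = Run (A σ T) σ T

SimRun : {n : ℕ} → (ℕ → Fin n) → ℕ → (ℕ → ℕ) → ℕ → (ℕ → Subset n) → (ℕ → Maybe (Fin n)) → Set
SimRun σ T p Z = Run (phat σ p Z) σ T

dist : {n : ℕ} → ℕ → Subset n → Subset n → ℕ
dist k C Ĉ = k ∸ ∣ C ∩ Ĉ ∣

-- The distance grows exactly when the overlap C_t ∩ Ĉ_t shrinks. On a miss the requested page
-- enters the overlap, so the overlap can only shrink if it loses two pages: both algorithms
-- miss and evict different pages e ≠ ê, each lying in the other cache. FitF evicts e although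
-- ê ∈ C_t, so A_t(ê) ≤ A_t(e), strictly because A_t is injective (A_t(i) is a round requesting
-- i); Sim evicts ê although e ∈ Ĉ_t, so p̂_t(e) ≤ p̂_t(ê).
module Submission where

open import Data.Nat using (ℕ; zero; suc; _+_; _∸_; _≤_; _<_; s≤s; z<s; _≤?_; _<?_)
open import Data.Nat.Properties
open import Data.Fin using (Fin; toℕ; zero; suc) renaming (_≟_ to _≟ᶠ_)
open import Data.Fin.Properties using (toℕ-injective; toℕ<n; toℕ-fromℕ<)
open import Data.Fin.Subset using (Subset; ∣_∣; _∈_; _∉_; _⊆_; _─_; _-_; _∪_; _∩_; ⁅_⁆; inside; outside)
open import Data.Fin.Subset.Properties
open import Data.Vec.Base using (_∷_; here; there)
open import Data.Maybe using (Maybe; just; nothing)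
open import Data.Maybe.Properties using (just-injective)
open import Data.Product using (_×_; ∃₂; _,_; proj₁; proj₂)
open import Data.Sum using (inj₁; inj₂)
open import Data.Empty using (⊥-elim)
open import Function using (_∘_; case_of_)
open import Relation.Binary.PropositionalEquality
open import Relation.Nullary using (yes; no)
open import Defs

x∈p─q⇒x∉q : ∀ {n} {x : Fin n} (p q : Subset n) → x ∈ p ─ q → x ∉ q
x∈p─q⇒x∉q (_ ∷ p) (inside ∷ q) () here
x∈p─q⇒x∉q (_ ∷ p) (_ ∷ q) (there x∈p─q) (there x∈q) = x∈p─q⇒x∉q p q x∈p─q x∈q

∣p∪⁅x⁆∣≤1+∣p∣ : ∀ {n} (p : Subset n) (x : Fin n) → ∣ p ∪ ⁅ x ⁆ ∣ ≤ suc ∣ p ∣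
∣p∪⁅x⁆∣≤1+∣p∣ (inside ∷ p)  zero    rewrite ∪-identityʳ p = n≤1+n (suc ∣ p ∣)
∣p∪⁅x⁆∣≤1+∣p∣ (outside ∷ p) zero    rewrite ∪-identityʳ p = ≤-refl
∣p∪⁅x⁆∣≤1+∣p∣ (inside ∷ p)  (suc x) = s≤s (∣p∪⁅x⁆∣≤1+∣p∣ p x)
∣p∪⁅x⁆∣≤1+∣p∣ (outside ∷ p) (suc x) = ∣p∪⁅x⁆∣≤1+∣p∣ p x

∣p∣≤1+∣p-x∣ : ∀ {n} (p : Subset n) (x : Fin n) → ∣ p ∣ ≤ suc ∣ p - x ∣
∣p∣≤1+∣p-x∣ p x = ≤-trans (p⊆q⇒∣p∣≤∣q∣ p⊆p-x∪⁅x⁆) (∣p∪⁅x⁆∣≤1+∣p∣ (p - x) x)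
  where
  p⊆p-x∪⁅x⁆ : p ⊆ (p - x) ∪ ⁅ x ⁆
  p⊆p-x∪⁅x⁆ {z} z∈p with z ≟ᶠ x
  ... | yes refl = x∈p∪q⁺ (inj₂ (x∈⁅x⁆ x))
  ... | no z≢x   = x∈p∪q⁺ (inj₁ (x∈p∧x≢y⇒x∈p-y z∈p z≢x))

p-x⊆q∧y∈q∧y∉p⇒∣p∣≤∣q∣ : ∀ {n} {p q : Subset n} {x y : Fin n} →
                        p - x ⊆ q → y ∈ q → y ∉ p → ∣ p ∣ ≤ ∣ q ∣
p-x⊆q∧y∈q∧y∉p⇒∣p∣≤∣q∣ {p = p} {x = x} p-x⊆q y∈q y∉p =
  ≤-trans (∣p∣≤1+∣p-x∣ p x) (p⊂q⇒∣p∣<∣q∣ (p-x⊆q , _ , y∈q , y∉p ∘ p─q⊆p p ⁅ x ⁆))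

module _ {n : ℕ} {score : Fin n → ℕ} {r : Fin n} {C C′ : Subset n} {e : Maybe (Fin n)} where

  Step-serves : Step score r C C′ e → r ∈ C′
  Step-serves (inj₁ (r∈C , refl , _))          = r∈C
  Step-serves (inj₂ (_ , _ , _ , _ , refl , _)) = x∈p∪q⁺ (inj₂ (x∈⁅x⁆ r))

  Step-keeps : Step score r C C′ e → ∀ {z} → z ∈ C → e ≢ just z → z ∈ C′
  Step-keeps (inj₁ (_ , refl , _))                 z∈C _      = z∈C
  Step-keeps (inj₂ (_ , _ , _ , refl , refl , _)) z∈C x≢z =
    x∈p∪q⁺ (inj₁ (x∈p∧x≢y⇒x∈p-y z∈C (x≢z ∘ cong just ∘ sym)))

  Step-miss : Step score r C C′ e → ∀ {x} → e ≡ just x → r ∉ C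
  Step-miss (inj₁ (_ , _ , refl)) ()
  Step-miss (inj₂ (_ , r∉C , _)) _ = r∉C

  Step-evicts-maximal : Step score r C C′ e → ∀ {x y} → e ≡ just x → y ∈ C → score y ≤ score x
  Step-evicts-maximal (inj₁ (_ , _ , refl)) ()
  Step-evicts-maximal (inj₂ (_ , _ , _ , refl , _ , maximal)) refl = maximal _

CrossedEvictions : ∀ {n} → Subset n → Subset n → Maybe (Fin n) → Maybe (Fin n) → Set
CrossedEvictions C Ĉ e ê = ∃₂ λ x x̂ → e ≡ just x × ê ≡ just x̂ × x ∈ Ĉ × x̂ ∈ C × x ≢ x̂

module _ {n : ℕ} {score ŝcore : Fin n → ℕ} {r : Fin n} {C C′ Ĉ Ĉ′ : Subset n} where

  overlap-shrinks⇒crossed-evictions :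
    {e ê : Maybe (Fin n)} → Step score r C C′ e → Step ŝcore r Ĉ Ĉ′ ê →
    ∣ C′ ∩ Ĉ′ ∣ < ∣ C ∩ Ĉ ∣ → CrossedEvictions C Ĉ e ê
  overlap-shrinks⇒crossed-evictions {e} {ê} step ŝtep shrinks = crossed e ê refl refl
    where
    kept : ∀ {z} → z ∈ C ∩ Ĉ → e ≢ just z → ê ≢ just z → z ∈ C′ ∩ Ĉ′
    kept z∈I e≢z ê≢z = x∈p∩q⁺ ( Step-keeps step (proj₁ (x∈p∩q⁻ C Ĉ z∈I)) e≢z
                              , Step-keeps ŝtep (proj₂ (x∈p∩q⁻ C Ĉ z∈I)) ê≢z)

    loses-at-most : (x : Fin n) → r ∉ C ∩ Ĉ →
                    (∀ {z} → z ∈ C ∩ Ĉ → z ≢ x → z ∈ C′ ∩ Ĉ′) → ∣ C ∩ Ĉ ∣ ≤ ∣ C′ ∩ Ĉ′ ∣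
    loses-at-most x r∉I keeps = p-x⊆q∧y∈q∧y∉p⇒∣p∣≤∣q∣
      (λ z∈I-x → keeps (p─q⊆p _ ⁅ x ⁆ z∈I-x) (x∉⁅y⁆⇒x≢y (x∈p─q⇒x∉q _ ⁅ x ⁆ z∈I-x)))
      (x∈p∩q⁺ (Step-serves step , Step-serves ŝtep)) r∉I

    missed : ∀ {x} → e ≡ just x → r ∉ C ∩ Ĉ
    missed e≡x = Step-miss step e≡x ∘ proj₁ ∘ x∈p∩q⁻ C Ĉ

    m̂issed : ∀ {x̂} → ê ≡ just x̂ → r ∉ C ∩ Ĉ
    m̂issed ê≡x̂ = Step-miss ŝtep ê≡x̂ ∘ proj₂ ∘ x∈p∩q⁻ C Ĉ

    spares : ∀ {x z : Fin n} → z ≢ x → just x ≢ just z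
    spares z≢x = z≢x ∘ sym ∘ just-injective

    impossible : ∣ C ∩ Ĉ ∣ ≤ ∣ C′ ∩ Ĉ′ ∣ → CrossedEvictions C Ĉ e ê
    impossible = ⊥-elim ∘ <⇒≱ shrinks

    crossed : (e₀ ê₀ : Maybe (Fin n)) → e ≡ e₀ → ê ≡ ê₀ → CrossedEvictions C Ĉ e ê
    crossed nothing nothing refl refl =
      impossible (p⊆q⇒∣p∣≤∣q∣ λ z∈I → kept z∈I (λ ()) (λ ()))
    crossed nothing (just x̂) refl refl =
      impossible (loses-at-most x̂ (m̂issed refl) λ z∈I z≢x̂ → kept z∈I (λ ()) (spares z≢x̂))
    crossed (just x) nothing refl refl =
      impossible (loses-at-most x (missed refl) λ z∈I z≢x → kept z∈I (spares z≢x) (λ ()))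
    crossed (just x) (just x̂) refl refl with x ∈? Ĉ | x̂ ∈? C | x ≟ᶠ x̂
    ... | no x∉Ĉ | _ | _ = impossible (loses-at-most x̂ (missed refl) λ z∈I z≢x̂ →
          kept z∈I (spares λ { refl → x∉Ĉ (proj₂ (x∈p∩q⁻ C Ĉ z∈I)) }) (spares z≢x̂))
    ... | yes _ | no x̂∉C | _ = impossible (loses-at-most x (missed refl) λ z∈I z≢x →
          kept z∈I (spares z≢x) (spares λ { refl → x̂∉C (proj₁ (x∈p∩q⁻ C Ĉ z∈I)) }))
    ... | yes _ | yes _ | yes refl = impossible (loses-at-most x (missed refl) λ z∈I z≢x →
          kept z∈I (spares z≢x) (spares z≢x))
    ... | yes x∈Ĉ | yes x̂∈C | no x≢x̂ = x , x̂ , refl , refl , x∈Ĉ , x̂∈C , x≢x̂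

1+m+n∸m∸1≡n : ∀ m n → suc (m + n) ∸ m ∸ 1 ≡ n
1+m+n∸m∸1≡n m n = cong (_∸ 1) (trans (cong (_∸ m) (sym (+-suc m n))) (m+n∸m≡n m (suc n)))

module _ {n : ℕ} (σ : ℕ → Fin n) (T : ℕ) where

  searchNext-finds : ∀ {i} f s {t′} → s ≤ t′ → t′ < f + s → ext σ T t′ ≡ just i →
                     ext σ T (searchNext σ T i f s) ≡ just i
  searchNext-passes : ∀ {i} f s {t′} → s ≤ t′ → t′ < suc f + s → ext σ T t′ ≡ just i →
                      ext σ T s ≢ just i → ext σ T (searchNext σ T i f (suc s)) ≡ just i

  searchNext-finds zero s s≤t′ t′<s _ = ⊥-elim (<⇒≱ t′<s s≤t′)
  searchNext-finds {i} (suc f) s s≤t′ t′<1+f+s hit with ext σ T s in ext-s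
  ... | nothing = searchNext-passes f s s≤t′ t′<1+f+s hit
                    λ ext-s≡i → case trans (sym ext-s) ext-s≡i of λ ()
  ... | just j with j ≟ᶠ i
  ...   | yes refl = ext-s
  ...   | no j≢i = searchNext-passes f s s≤t′ t′<1+f+s hit
                     (j≢i ∘ just-injective ∘ trans (sym ext-s))

  searchNext-passes f s {t′} s≤t′ t′<1+f+s hit miss with m≤n⇒m<n∨m≡n s≤t′
  ... | inj₁ s<t′ = searchNext-finds f (suc s) s<t′ (subst (t′ <_) (sym (+-suc f s)) t′<1+f+s) hit
  ... | inj₂ refl = ⊥-elim (miss hit)

  ext-virtual : (i : Fin n) → ext σ T (suc (T + toℕ i)) ≡ just i
  ext-virtual i with suc (T + toℕ i) ≤? T
  ... | yes T<T+i = ⊥-elim (<⇒≱ T<T+i (m≤m+n T (toℕ i)))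
  ... | no _ with suc (T + toℕ i) ∸ T ∸ 1 <? n
  ...   | yes i<n = cong just (toℕ-injective (trans (toℕ-fromℕ< i<n) (1+m+n∸m∸1≡n T (toℕ i))))
  ...   | no i≮n  = ⊥-elim (i≮n (subst (_< n) (sym (1+m+n∸m∸1≡n T (toℕ i))) (toℕ<n i)))

  ext-A : ∀ {t} → t ≤ T → (i : Fin n) → ext σ T (A σ T t i) ≡ just i
  ext-A t≤T i = searchNext-finds (T + n) _ (s≤s (≤-trans t≤T (m≤m+n T (toℕ i))))
    (≤-<-trans (+-monoʳ-< T (toℕ<n i)) (m<m+n (T + n) z<s)) (ext-virtual i)

  A-injective : ∀ {t} → t ≤ T → {i j : Fin n} → A σ T t i ≡ A σ T t j → i ≡ j
  A-injective t≤T {i} {j} Ai≡Aj =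
    just-injective (trans (sym (ext-A t≤T i)) (trans (cong (ext σ T) Ai≡Aj) (ext-A t≤T j)))

lemma14 : (n k T : ℕ) → k < n → (σ : ℕ → Fin n)
    → (p : ℕ → ℕ) → (∀ t → 1 ≤ t → t ≤ T → t < p t × p t ≤ T + n)
    → (Z : ℕ) → T + n < Z
    → (C Ĉ : ℕ → Subset n) (E Ê : ℕ → Maybe (Fin n))
    → ∣ C 1 ∣ ≡ k → ∣ Ĉ 1 ∣ ≡ k
    → FitFRun σ T C E → SimRun σ T p Z Ĉ Ê
    → (t : ℕ) → 1 ≤ t → t ≤ T
    → dist k (C (suc t)) (Ĉ (suc t)) ≡ suc (dist k (C t) (Ĉ t))
    → ∃₂ λ e ê → E t ≡ just e × Ê t ≡ just ê
        × A σ T t ê < A σ T t e × phat σ p Z t e ≤ phat σ p Z t ê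
lemma14 n k T _ σ p _ Z _ C Ĉ E Ê _ _ fitf sim t 1≤t t≤T grows =
  let step  = fitf t 1≤t t≤T
      ŝtep  = sim t 1≤t t≤T
      e , ê , E≡e , Ê≡ê , e∈Ĉ , ê∈C , e≢ê =
        overlap-shrinks⇒crossed-evictions step ŝtep (∸-cancelʳ-< (≤-reflexive (sym grows)))
  in e , ê , E≡e , Ê≡ê ,
     ≤∧≢⇒< (Step-evicts-maximal step E≡e ê∈C) (e≢ê ∘ sym ∘ A-injective σ T t≤T) ,
     Step-evicts-maximal ŝtep Ê≡ê e∈Ĉ
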